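{- Let $d\geq 3$ and let $G$ be a $d$-regular graph on $n$ vertices with $d+1<n<2(d+1)$. Let $ab$ be any edge of $G$. Then there is a graph $G'$ obtained from $G$ by at most one $\Delta$-switch such that $G'$ contains a triangle having $a$ as one of its vertices, and such that the set of edges incident with $b$ is the same in $G'$ as in $G$.
   Context: All graphs are simple. A $\Delta^+$-switch in a graph $G=(V,E)$: if $v,x,y,w,z$ are distinct vertices such that $yx, xv, vw, wz\in E$ and $xw, yz\notin E$, delete the edges $xy$, $wz$ and insert the edges $xw$, $yz$. A $\Delta^-$-switch is the reverse operation: if $v,x,y,w,z$ are distinct, $G$ contains the triangle on $v,x,w$ and the edge $yz$, and $xy, wz\notin E$, delete $xw$, $yz$ and insert $xy$, $wz$. A $\Delta$-switch is a $\Delta^+$-switch or a $\Delta^-$-switch. -}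

module Defs where

open import Data.Nat using (ℕ; _+_)
open import Data.Bool using (Bool; true; false; _∧_; _∨_; not; if_then_else_)
open import Data.Fin using (Fin; _≟_)
open import Data.List using (List; map; allFin)
open import Data.Nat.ListAction using (sum)
open import Data.Product using (Σ; _×_; ∃; _,_)
open import Data.Sum using (_⊎_)
open import Relation.Nullary using (¬_)
open import Relation.Nullary.Decidable using (⌊_⌋)
open import Relation.Binary.PropositionalEquality using (_≡_)

record Graph (n : ℕ) : Set where
  field
    adj    : Fin n → Fin n → Bool
    sym    : ∀ i j → adj i j ≡ adj j i
    irrefl : ∀ i → adj i i ≡ false
open Graph public

Edge : ∀ {n} → Graph n → Fin n → Fin n → Set
Edge G i j = adj G i j ≡ true

NonEdge : ∀ {n} → Graph n → Fin n → Fin n → Set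
NonEdge G i j = adj G i j ≡ false

deg : ∀ {n} → Graph n → Fin n → ℕ
deg {n} G i = sum (map (λ j → if adj G i j then 1 else 0) (allFin n))

Regular : ∀ {n} → ℕ → Graph n → Set
Regular {n} d G = ∀ (i : Fin n) → deg G i ≡ d

Distinct5 : ∀ {n} → Fin n → Fin n → Fin n → Fin n → Fin n → Set
Distinct5 v x y w z =
  ¬ v ≡ x × ¬ v ≡ y × ¬ v ≡ w × ¬ v ≡ z ×
  ¬ x ≡ y × ¬ x ≡ w × ¬ x ≡ z ×
  ¬ y ≡ w × ¬ y ≡ z ×
  ¬ w ≡ z

isPair : ∀ {n} → Fin n → Fin n → Fin n → Fin n → Bool
isPair x y i j = (⌊ i ≟ x ⌋ ∧ ⌊ j ≟ y ⌋) ∨ (⌊ i ≟ y ⌋ ∧ ⌊ j ≟ x ⌋)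

Replace : ∀ {n} → Graph n → Graph n →
          (p q r s t u v w : Fin n) → Set
Replace {n} G G' p q r s t u v w =
  ∀ (i j : Fin n) →
    adj G' i j ≡
      ((adj G i j ∧ not (isPair p q i j) ∧ not (isPair r s i j))
        ∨ isPair t u i j ∨ isPair v w i j)

DeltaPlus : ∀ {n} → Graph n → Graph n → Set
DeltaPlus {n} G G' = Σ (Fin n) λ v → Σ (Fin n) λ x → Σ (Fin n) λ y →
  Σ (Fin n) λ w → Σ (Fin n) λ z →
    Distinct5 v x y w z ×
    Edge G y x × Edge G x v × Edge G v w × Edge G w z ×
    NonEdge G x w × NonEdge G y z ×
    Replace G G' x y w z x w y z

DeltaMinus : ∀ {n} → Graph n → Graph n → Set
DeltaMinus {n} G G' = Σ (Fin n) λ v → Σ (Fin n) λ x → Σ (Fin n) λ y →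
  Σ (Fin n) λ w → Σ (Fin n) λ z →
    Distinct5 v x y w z ×
    Edge G v x × Edge G x w × Edge G w v × Edge G y z ×
    NonEdge G x y × NonEdge G w z ×
    Replace G G' x w y z x y w z

DeltaSwitch : ∀ {n} → Graph n → Graph n → Set
DeltaSwitch G G' = DeltaPlus G G' ⊎ DeltaMinus G G'

SameGraph : ∀ {n} → Graph n → Graph n → Set
SameGraph {n} G G' = ∀ (i j : Fin n) → adj G' i j ≡ adj G i j

AtMostOneSwitch : ∀ {n} → Graph n → Graph n → Set
AtMostOneSwitch G G' = SameGraph G G' ⊎ DeltaSwitch G G'

TriangleAt : ∀ {n} → Graph n → Fin n → Set
TriangleAt {n} G a = Σ (Fin n) λ u → Σ (Fin n) λ w →
  Edge G a u × Edge G u w × Edge G w a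

-- If a lies on a triangle, take G' = G. Otherwise N(a) is independent; pick x, w ∈ N(a) other
-- than b. If some y ∈ N(x) − a and z ∈ N(w) − a are distinct and non-adjacent, the Δ⁺-switch on
-- the path y x a w z creates the triangle a x w, and it touches no edge at b because y, z ∉ N(a).
-- Otherwise every y ∈ N(x) − a is adjacent to all of N(w) − {a, y}, to x, and to w if y ∈ N(w);
-- were y adjacent to b as well, it would have degree d + 1. So the d − 1 ≥ 2 vertices of
-- N(x) − a lie outside the disjoint d-sets N(a) and N(b), forcing n ≥ 2(d + 1).
module Submission where

open import Defs hiding (sym)
open import Data.Nat using (ℕ; zero; suc; _+_; _*_; _≤_; _<_; s≤s; s≤s⁻¹)
open import Data.Nat.Properties
  using (≤-refl; ≤-trans; ≤-<-trans; n≤1+n; <-irrefl; <⇒≱; m+[n∸m]≡n; +-monoʳ-≤; module ≤-Reasoning)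
open import Data.Nat.Tactic.RingSolver using (solve-∀)
open import Data.Bool using (Bool; true; false; if_then_else_; _∧_; _∨_; not)
import Data.Bool as Bool
open import Data.Bool.Properties using (¬-not; ∧-comm; ∨-comm; ∧-identityʳ; ∨-identityʳ; ∨-zeroʳ)
open import Data.Fin using (Fin; zero; suc; _≟_)
open import Data.Fin.Properties using (any?)
open import Data.Fin.Subset
  using (Subset; inside; outside; _∈_; _∉_; _⊆_; ∁; ⁅_⁆; _-_; ∣_∣; Nonempty)
open import Data.Fin.Subset.Properties
  using (⊆-refl; p⊆q⇒∣p∣≤∣q∣; x∈p⇒∣p-x∣<∣p∣; x∈p∧x≢y⇒x∈p-y; p─q⊆p; p─⊥≡p;
         nonempty?; Empty-unique; _∈?_; ∣⊥∣≡0; ∣p∣≤n; ∣∁p∣≡n∸∣p∣; x∉p⇒x∈∁p)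
open import Data.Vec using (_∷_; there; tabulate)
open import Data.Vec.Properties using (lookup∘tabulate; []=⇒lookup; lookup⇒[]=)
import Data.List as List
open import Data.List.Properties using (map-tabulate)
open import Data.Nat.ListAction using (sum)
open import Function using (_∘_; id; case_of_)
open import Data.Product using (Σ; ∃₂; _×_; _,_)
open import Data.Sum using (inj₁; inj₂)
open import Relation.Nullary using (¬_; Dec; yes; no; contradiction)
open import Relation.Nullary.Decidable using (⌊_⌋; _×-dec_; ¬?; decidable-stable)
open import Relation.Binary.PropositionalEquality
  using (_≡_; _≢_; ≢-sym; refl; sym; trans; cong; cong₂; subst)

private
  variable
    n : ℕ
    p q : Subset n
    x y : Fin n

∣p∣≤1+∣p-x∣ : ∀ (p : Subset n) x → ∣ p ∣ ≤ suc ∣ p - x ∣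
∣p∣≤1+∣p-x∣ (inside  ∷ p) zero    = subst (λ r → suc ∣ p ∣ ≤ suc ∣ r ∣) (sym (p─⊥≡p p)) ≤-refl
∣p∣≤1+∣p-x∣ (outside ∷ p) zero    = subst (λ r → ∣ p ∣ ≤ suc ∣ r ∣) (sym (p─⊥≡p p)) (n≤1+n _)
∣p∣≤1+∣p-x∣ (inside  ∷ p) (suc x) = s≤s (∣p∣≤1+∣p-x∣ p x)
∣p∣≤1+∣p-x∣ (outside ∷ p) (suc x) = ∣p∣≤1+∣p-x∣ p x

m<∣p∣⇒m≤∣p-x∣ : ∀ {m} (p : Subset n) x → m < ∣ p ∣ → m ≤ ∣ p - x ∣
m<∣p∣⇒m≤∣p-x∣ p x m<∣p∣ = s≤s⁻¹ (≤-trans m<∣p∣ (∣p∣≤1+∣p-x∣ p x))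

x∉p-x : ∀ (p : Subset n) x → x ∉ p - x
x∉p-x (_ ∷ p) zero    ()
x∉p-x (_ ∷ p) (suc x) (there x∈p-x) = x∉p-x p x x∈p-x

x∈p-y⇒x≢y : x ∈ p - y → x ≢ y
x∈p-y⇒x≢y {p = p} {y = y} x∈p-y refl = x∉p-x p y x∈p-y

⊆-remove : p ⊆ q → x ∉ p → p ⊆ q - x
⊆-remove p⊆q x∉p i∈p = x∈p∧x≢y⇒x∈p-y (p⊆q i∈p) λ { refl → x∉p i∈p }

∣p∣>0⇒Nonempty : 0 < ∣ p ∣ → Nonempty p
∣p∣>0⇒Nonempty {n} {p} 0<∣p∣ with nonempty? p
... | yes p≢∅ = p≢∅
... | no  p≡∅ with refl ← Empty-unique p≡∅ = contradiction (subst (0 <_) (∣⊥∣≡0 n) 0<∣p∣) λ ()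

two-besides : ∀ (p : Subset n) e → 2 < ∣ p ∣ →
              ∃₂ λ x y → x ∈ p × y ∈ p × x ≢ e × y ≢ e × x ≢ y
two-besides p e 2<∣p∣
  with x , x∈p-e   ← ∣p∣>0⇒Nonempty {p = p - e} (m<∣p∣⇒m≤∣p-x∣ p e (≤-trans (n≤1+n 2) 2<∣p∣))
  with y , y∈p-e-x ← ∣p∣>0⇒Nonempty {p = p - e - x}
                        (m<∣p∣⇒m≤∣p-x∣ (p - e) x (m<∣p∣⇒m≤∣p-x∣ p e 2<∣p∣))
  = let y∈p-e = p─q⊆p (p - e) ⁅ x ⁆ y∈p-e-x in
    x , y , p─q⊆p p ⁅ e ⁆ x∈p-e , p─q⊆p p ⁅ e ⁆ y∈p-e ,
    x∈p-y⇒x≢y {p = p} x∈p-e , x∈p-y⇒x≢y {p = p} y∈p-e ,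
    λ x≡y → x∈p-y⇒x≢y {p = p - e} y∈p-e-x (sym x≡y)

two-outside : p ⊆ q → x ∈ q → y ∈ q → x ∉ p → y ∉ p → x ≢ y → 2 + ∣ p ∣ ≤ ∣ q ∣
two-outside {p = p} {q} {x} {y} p⊆q x∈q y∈q x∉p y∉p x≢y =
  ≤-trans (s≤s (≤-<-trans (p⊆q⇒∣p∣≤∣q∣ p⊆q-x-y) (x∈p⇒∣p-x∣<∣p∣ y∈q-x))) (x∈p⇒∣p-x∣<∣p∣ x∈q)
  where
  p⊆q-x-y : p ⊆ q - x - y
  p⊆q-x-y = ⊆-remove (⊆-remove p⊆q x∉p) y∉p
  y∈q-x : y ∈ q - x
  y∈q-x = x∈p∧x≢y⇒x∈p-y y∈q (λ y≡x → x≢y (sym y≡x))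

∣p∣+∣∁p∣≡n : ∀ (p : Subset n) → ∣ p ∣ + ∣ ∁ p ∣ ≡ n
∣p∣+∣∁p∣≡n p = trans (cong (∣ p ∣ +_) (∣∁p∣≡n∸∣p∣ p)) (m+[n∸m]≡n (∣p∣≤n p))

∣tabulate∣≡sum : ∀ (f : Fin n → Bool) →
                 ∣ tabulate f ∣ ≡ sum (List.tabulate (λ j → if f j then 1 else 0))
∣tabulate∣≡sum {zero}  f = refl
∣tabulate∣≡sum {suc n} f with f zero
... | true  = cong suc (∣tabulate∣≡sum (f ∘ suc))
... | false = ∣tabulate∣≡sum (f ∘ suc)

N : Graph n → Fin n → Subset n
N G v = tabulate (adj G v)

module _ (G : Graph n) where

  ∈N⇒Edge : ∀ {v j} → j ∈ N G v → Edge G v j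
  ∈N⇒Edge {v = v} {j = j} j∈N = trans (sym (lookup∘tabulate (adj G v) j)) ([]=⇒lookup j∈N)

  Edge⇒∈N : ∀ {v j} → Edge G v j → j ∈ N G v
  Edge⇒∈N {v = v} {j = j} e = lookup⇒[]= j (N G v) (trans (lookup∘tabulate (adj G v) j) e)

  ∉N⇒NonEdge : ∀ {v j} → j ∉ N G v → NonEdge G v j
  ∉N⇒NonEdge j∉N = ¬-not λ e → j∉N (Edge⇒∈N e)

  ∈N-sym : ∀ {v j} → j ∈ N G v → v ∈ N G j
  ∈N-sym {v = v} {j = j} j∈N = Edge⇒∈N (trans (Graph.sym G j v) (∈N⇒Edge j∈N))

  ∈N⇒≢ : ∀ {v j} → j ∈ N G v → v ≢ j
  ∈N⇒≢ {v = v} j∈N refl = case trans (sym (∈N⇒Edge j∈N)) (irrefl G v) of λ ()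

∣N∣≡deg : ∀ (G : Graph n) v → ∣ N G v ∣ ≡ deg G v
∣N∣≡deg G v =
  trans (∣tabulate∣≡sum (adj G v)) (cong sum (sym (map-tabulate id (λ j → if adj G v j then 1 else 0))))

isPair-comm : ∀ (x y i j : Fin n) → isPair x y i j ≡ isPair x y j i
isPair-comm x y i j =
  trans (cong₂ _∨_ (∧-comm ⌊ i ≟ x ⌋ _) (∧-comm ⌊ i ≟ y ⌋ _)) (∨-comm (⌊ j ≟ y ⌋ ∧ _) _)

isPair-refl : ∀ (x y : Fin n) → isPair x y x y ≡ true
isPair-refl x y with x ≟ x | y ≟ y
... | yes _ | yes _   = refl
... | no x≢x | _      = contradiction refl x≢x
... | yes _ | no y≢y  = contradiction refl y≢y

isPair-≢ : ∀ {i} (j : Fin n) → i ≢ x → i ≢ y → isPair x y i j ≡ false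
isPair-≢ {x = x} {y} {i} j i≢x i≢y with i ≟ x | i ≟ y
... | yes i≡x | _       = contradiction i≡x i≢x
... | no _    | yes i≡y = contradiction i≡y i≢y
... | no _    | no _    = refl

isPair-diag : ∀ (i : Fin n) → x ≢ y → isPair x y i i ≡ false
isPair-diag {x = x} {y} i x≢y with i ≟ x | i ≟ y
... | yes refl | yes refl = contradiction refl x≢y
... | yes _    | no _     = refl
... | no _     | yes _    = refl
... | no _     | no _     = refl

Δ⁺-switch : (G : Graph n) (x y w z : Fin n) → x ≢ w → y ≢ z → Graph n
Δ⁺-switch {n} G x y w z x≢w y≢z = record
  { adj    = switched
  ; sym    = λ i j → cong₂ _∨_
      (cong₂ _∧_ (Graph.sym G i j)
                 (cong₂ _∧_ (cong not (isPair-comm x y i j)) (cong not (isPair-comm w z i j))))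
      (cong₂ _∨_ (isPair-comm x w i j) (isPair-comm y z i j))
  ; irrefl = λ i → cong₂ _∨_ (cong (_∧ _) (irrefl G i))
                             (cong₂ _∨_ (isPair-diag i x≢w) (isPair-diag i y≢z))
  }
  where
  switched : Fin n → Fin n → Bool
  switched i j =
    (adj G i j ∧ not (isPair x y i j) ∧ not (isPair w z i j)) ∨ isPair x w i j ∨ isPair y z i j

module _ (G : Graph n) {x y w z : Fin n} (x≢w : x ≢ w) (y≢z : y ≢ z) where

  Δ⁺-switch-replaces : Replace G (Δ⁺-switch G x y w z x≢w y≢z) x y w z x w y z
  Δ⁺-switch-replaces i j = refl

  Δ⁺-switch-inserts : Edge (Δ⁺-switch G x y w z x≢w y≢z) x w
  Δ⁺-switch-inserts rewrite isPair-refl x w = ∨-zeroʳ _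

  Δ⁺-switch-fixes : ∀ {i} j → i ≢ x → i ≢ y → i ≢ w → i ≢ z →
                    adj (Δ⁺-switch G x y w z x≢w y≢z) i j ≡ adj G i j
  Δ⁺-switch-fixes j i≢x i≢y i≢w i≢z
    rewrite isPair-≢ j i≢x i≢y | isPair-≢ j i≢w i≢z | isPair-≢ j i≢x i≢w | isPair-≢ j i≢y i≢z =
    trans (∨-identityʳ _) (∧-identityʳ _)

module TriangleFreeAt {n d : ℕ} (G : Graph n) (regular : ∀ v → ∣ N G v ∣ ≡ d)
                      (a : Fin n) (no-triangle : ¬ TriangleAt G a) where

  N-independent : ∀ {u w} → u ∈ N G a → w ∈ N G a → w ∉ N G u
  N-independent u∈N[a] w∈N[a] w∈N[u] =
    no-triangle (_ , _ , ∈N⇒Edge G u∈N[a] , ∈N⇒Edge G w∈N[u] , ∈N⇒Edge G (∈N-sym G w∈N[a]))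

  N²-avoids-N : ∀ {u y} → u ∈ N G a → y ∈ N G u → y ∉ N G a
  N²-avoids-N u∈N[a] y∈N[u] y∈N[a] = N-independent u∈N[a] y∈N[a] y∈N[u]

  SwitchPair : Fin n → Fin n → Set
  SwitchPair x w = ∃₂ λ y z → y ∈ N G x - a × z ∈ N G w - a × y ≢ z × z ∉ N G y

  switchPair? : ∀ x w → Dec (SwitchPair x w)
  switchPair? x w = any? λ y → any? λ z →
    y ∈? N G x - a ×-dec z ∈? N G w - a ×-dec ¬? (y ≟ z) ×-dec ¬? (z ∈? N G y)

  CompletelyJoined : Fin n → Fin n → Set
  CompletelyJoined x w = ∀ {y z} → y ∈ N G x - a → z ∈ N G w - a → y ≢ z → z ∈ N G y

  ¬SwitchPair⇒CompletelyJoined : ∀ {x w} → ¬ SwitchPair x w → CompletelyJoined x w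
  ¬SwitchPair⇒CompletelyJoined ¬pair {y} {z} y∈ z∈ y≢z =
    decidable-stable (z ∈? N G y) λ z∉N[y] → ¬pair (y , z , y∈ , z∈ , y≢z , z∉N[y])

  CompletelyJoined⇒∉N : ∀ {x w b y} → CompletelyJoined x w →
    x ∈ N G a → w ∈ N G a → b ∈ N G a → x ≢ w → x ≢ b → w ≢ b →
    y ∈ N G x - a → y ∉ N G b
  CompletelyJoined⇒∉N {x} {w} {b} {y} joined x∈N[a] w∈N[a] b∈N[a] x≢w x≢b w≢b y∈N[x]-a y∈N[b] =
    case w ∈? N G y of λ where
      (yes w∈N[y]) → <-irrefl refl (begin-strict
        d                  ≡⟨ sym (regular w) ⟩
        ∣ N G w ∣          ≤⟨ ∣p∣≤1+∣p-x∣ (N G w) a ⟩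
        suc ∣ N G w - a ∣   ≤⟨ s≤s (∣p∣≤1+∣p-x∣ (N G w - a) y) ⟩
        2 + ∣ F ∣           ≤⟨ two-outside (⊆-remove F⊆N[y] w∉F) (x∈p∧x≢y⇒x∈p-y x∈N[y] x≢w)
                                 (x∈p∧x≢y⇒x∈p-y b∈N[y] (≢-sym w≢b)) x∉F b∉F x≢b ⟩
        ∣ N G y - w ∣       <⟨ x∈p⇒∣p-x∣<∣p∣ w∈N[y] ⟩
        ∣ N G y ∣          ≡⟨ regular y ⟩
        d                  ∎)
      (no w∉N[y]) → let y∉N[w]-a = w∉N[y] ∘ ∈N-sym G ∘ p─q⊆p (N G w) ⁅ a ⁆ in
                    <-irrefl refl (begin-strict
        d                  ≡⟨ sym (regular w) ⟩
        ∣ N G w ∣          ≤⟨ ∣p∣≤1+∣p-x∣ (N G w) a ⟩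
        suc ∣ N G w - a ∣   ≤⟨ s≤s (p⊆q⇒∣p∣≤∣q∣ (⊆-remove ⊆-refl y∉N[w]-a)) ⟩
        suc ∣ F ∣           <⟨ two-outside F⊆N[y] x∈N[y] b∈N[y] x∉F b∉F x≢b ⟩
        ∣ N G y ∣          ≡⟨ regular y ⟩
        d                  ∎)
    where
    open ≤-Reasoning
    F : Subset n
    F = N G w - a - y
    F⊆N[w] : F ⊆ N G w
    F⊆N[w] = p─q⊆p (N G w) ⁅ a ⁆ ∘ p─q⊆p (N G w - a) ⁅ y ⁆
    F⊆N[y] : F ⊆ N G y
    F⊆N[y] i∈F =
      joined y∈N[x]-a (p─q⊆p (N G w - a) ⁅ y ⁆ i∈F) (≢-sym (x∈p-y⇒x≢y {p = N G w - a} i∈F))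
    x∉F : x ∉ F
    x∉F = N-independent x∈N[a] w∈N[a] ∘ ∈N-sym G ∘ F⊆N[w]
    b∉F : b ∉ F
    b∉F = N-independent b∈N[a] w∈N[a] ∘ ∈N-sym G ∘ F⊆N[w]
    w∉F : w ∉ F
    w∉F w∈F = ∈N⇒≢ G (F⊆N[w] w∈F) refl
    x∈N[y] : x ∈ N G y
    x∈N[y] = ∈N-sym G (p─q⊆p (N G x) ⁅ a ⁆ y∈N[x]-a)
    b∈N[y] : b ∈ N G y
    b∈N[y] = ∈N-sym G y∈N[b]

  CompletelyJoined⇒2[d+1]≤n : 2 < d → ∀ {x w b} → CompletelyJoined x w →
    x ∈ N G a → w ∈ N G a → b ∈ N G a → x ≢ w → x ≢ b → w ≢ b → 2 * (d + 1) ≤ n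
  CompletelyJoined⇒2[d+1]≤n 2<d {x} {w} {b} joined x∈N[a] w∈N[a] b∈N[a] x≢w x≢b w≢b
    with y₁ , y₂ , y₁∈N[x] , y₂∈N[x] , y₁≢a , y₂≢a , y₁≢y₂
           ← two-besides (N G x) a (subst (2 <_) (sym (regular x)) 2<d) = begin
    2 * (d + 1)                      ≡⟨ 2*[m+1]≡m+[2+m] d ⟩
    d + (2 + d)                      ≡⟨ cong₂ (λ m k → m + (2 + k)) (sym (regular a)) (sym (regular b)) ⟩
    ∣ N G a ∣ + (2 + ∣ N G b ∣)      ≤⟨ +-monoʳ-≤ ∣ N G a ∣ (two-outside N[b]⊆∁N[a]
                                          (outside-N[a] y₁∈N[x]) (outside-N[a] y₂∈N[x])
                                          (∉N[b] y₁∈N[x] y₁≢a) (∉N[b] y₂∈N[x] y₂≢a) y₁≢y₂) ⟩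
    ∣ N G a ∣ + ∣ ∁ (N G a) ∣        ≡⟨ ∣p∣+∣∁p∣≡n (N G a) ⟩
    n                                ∎
    where
    open ≤-Reasoning
    2*[m+1]≡m+[2+m] : ∀ m → 2 * (m + 1) ≡ m + (2 + m)
    2*[m+1]≡m+[2+m] = solve-∀
    N[b]⊆∁N[a] : N G b ⊆ ∁ (N G a)
    N[b]⊆∁N[a] = x∉p⇒x∈∁p ∘ N²-avoids-N b∈N[a]
    outside-N[a] : ∀ {y} → y ∈ N G x → y ∈ ∁ (N G a)
    outside-N[a] = x∉p⇒x∈∁p ∘ N²-avoids-N x∈N[a]
    ∉N[b] : ∀ {y} → y ∈ N G x → y ≢ a → y ∉ N G b
    ∉N[b] y∈N[x] y≢a = CompletelyJoined⇒∉N joined x∈N[a] w∈N[a] b∈N[a] x≢w x≢b w≢b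
                         (x∈p∧x≢y⇒x∈p-y y∈N[x] y≢a)

  SwitchPair⇒Δ⁺-triangle : ∀ {x w b} → x ∈ N G a → w ∈ N G a → b ∈ N G a →
    x ≢ w → x ≢ b → w ≢ b → SwitchPair x w →
    Σ (Graph n) λ G' → DeltaPlus G G' × TriangleAt G' a × (∀ j → adj G' b j ≡ adj G b j)
  SwitchPair⇒Δ⁺-triangle {x} {w} {b} x∈N[a] w∈N[a] b∈N[a] x≢w x≢b w≢b
                         (y , z , y∈N[x]-a , z∈N[w]-a , y≢z , z∉N[y]) =
    G' , (a , x , y , w , z , distinct ,
          ∈N⇒Edge G (∈N-sym G y∈N[x]) , ∈N⇒Edge G (∈N-sym G x∈N[a]) , ∈N⇒Edge G w∈N[a] ,
          ∈N⇒Edge G z∈N[w] , ∉N⇒NonEdge G (N-independent x∈N[a] w∈N[a]) , ∉N⇒NonEdge G z∉N[y] ,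
          Δ⁺-switch-replaces G x≢w y≢z) ,
    (x , w , a-x , Δ⁺-switch-inserts G x≢w y≢z , trans (Graph.sym G' w a) a-w) ,
    λ j → Δ⁺-switch-fixes G x≢w y≢z j (≢-sym x≢b) b≢y (≢-sym w≢b) b≢z
    where
    G' : Graph n
    G' = Δ⁺-switch G x y w z x≢w y≢z
    y∈N[x] : y ∈ N G x
    y∈N[x] = p─q⊆p (N G x) ⁅ a ⁆ y∈N[x]-a
    z∈N[w] : z ∈ N G w
    z∈N[w] = p─q⊆p (N G w) ⁅ a ⁆ z∈N[w]-a
    a≢y : a ≢ y
    a≢y = ≢-sym (x∈p-y⇒x≢y {p = N G x} y∈N[x]-a)
    a≢z : a ≢ z
    a≢z = ≢-sym (x∈p-y⇒x≢y {p = N G w} z∈N[w]-a)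
    x≢z : x ≢ z
    x≢z x≡z = N-independent x∈N[a] w∈N[a] (∈N-sym G (subst (_∈ N G w) (sym x≡z) z∈N[w]))
    y≢w : y ≢ w
    y≢w y≡w = N-independent x∈N[a] w∈N[a] (subst (_∈ N G x) y≡w y∈N[x])
    b≢y : b ≢ y
    b≢y b≡y = N²-avoids-N x∈N[a] y∈N[x] (subst (_∈ N G a) b≡y b∈N[a])
    b≢z : b ≢ z
    b≢z b≡z = N²-avoids-N w∈N[a] z∈N[w] (subst (_∈ N G a) b≡z b∈N[a])
    distinct : Distinct5 a x y w z
    distinct = ∈N⇒≢ G x∈N[a] , a≢y , ∈N⇒≢ G w∈N[a] , a≢z ,
               ∈N⇒≢ G y∈N[x] , x≢w , x≢z , y≢w , y≢z , ∈N⇒≢ G z∈N[w]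
    a-fixed : ∀ j → adj G' a j ≡ adj G a j
    a-fixed j = Δ⁺-switch-fixes G x≢w y≢z j (∈N⇒≢ G x∈N[a]) a≢y (∈N⇒≢ G w∈N[a]) a≢z
    a-x : Edge G' a x
    a-x = trans (a-fixed x) (∈N⇒Edge G x∈N[a])
    a-w : Edge G' a w
    a-w = trans (a-fixed w) (∈N⇒Edge G w∈N[a])

  Δ⁺-switch-to-triangle : 2 < d → n < 2 * (d + 1) → ∀ {b} → b ∈ N G a →
    Σ (Graph n) λ G' → DeltaPlus G G' × TriangleAt G' a × (∀ j → adj G' b j ≡ adj G b j)
  Δ⁺-switch-to-triangle 2<d n<2[d+1] {b} b∈N[a]
    with x , w , x∈N[a] , w∈N[a] , x≢b , w≢b , x≢w
           ← two-besides (N G a) b (subst (2 <_) (sym (regular a)) 2<d)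
    with switchPair? x w
  ... | yes pair = SwitchPair⇒Δ⁺-triangle x∈N[a] w∈N[a] b∈N[a] x≢w x≢b w≢b pair
  ... | no ¬pair = contradiction
        (CompletelyJoined⇒2[d+1]≤n 2<d (¬SwitchPair⇒CompletelyJoined ¬pair)
                                   x∈N[a] w∈N[a] b∈N[a] x≢w x≢b w≢b)
        (<⇒≱ n<2[d+1])

triangleAt? : ∀ (G : Graph n) a → Dec (TriangleAt G a)
triangleAt? G a = any? λ u → any? λ w →
  adj G a u Bool.≟ true ×-dec adj G u w Bool.≟ true ×-dec adj G w a Bool.≟ true

lemma2p4 : (d n : ℕ) → 3 ≤ d → d + 1 < n → n < 2 * (d + 1) →
    (G : Graph n) → Regular d G →
    (a b : Fin n) → Edge G a b →
    Σ (Graph n) λ G' →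
      AtMostOneSwitch G G' × TriangleAt G' a ×
      (∀ (j : Fin n) → adj G' b j ≡ adj G b j)
lemma2p4 d n 3≤d _ n<2[d+1] G deg≡d a b ab with triangleAt? G a
... | yes triangle = G , inj₁ (λ _ _ → refl) , triangle , λ _ → refl
... | no no-triangle =
  let G' , Δ⁺ , triangle , b-fixed = Δ⁺-switch-to-triangle 3≤d n<2[d+1] (Edge⇒∈N G ab)
  in  G' , inj₂ (inj₁ Δ⁺) , triangle , b-fixed
  where open TriangleFreeAt G (λ v → trans (∣N∣≡deg G v) (deg≡d v)) a no-triangle
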